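{- Let $M'$ be a register machine with registers $R_1,\ldots,R_n$, each holding a natural number (written in binary), and a program consisting of a sequence $I_1,\ldots,I_k$ of instructions, execution starting at $I_1$, where each instruction has one of the following forms: $R^+\to I'$ (add $1$ to register $R$ and jump to instruction $I'$); $R^-\to I',I''$ (if the current number in $R$ is positive, subtract $1$ from it and jump to $I'$, otherwise jump to $I''$); HALT (stop). Then there is an AARM $M$ such that for every binary word $w$, $M$ accepts $w$ if and only if $M'$ halts when $R_1$ initially contains the number represented by $w$ and $R_i$ initially contains $0$ for each $i>1$.
   Context: For a finite alphabet $\Gamma$ and a symbol $\# \notin \Gamma$, the convolution $conv(x,y)$ of $x,y\in\Gamma^*$ is the string of length $\max(|x|,|y|)$ over $(\Gamma\cup\{\#\})^2$ whose $i$-th letter is $(x'_i,y'_i)$, where $x',y'$ are $x,y$ padded on the right with $\#$ to equal length. A relation $J\subseteq\Gamma^*\times\Gamma^*$ is automatic if $\{conv(x,y):(x,y)\in J\}$ is regular, and bounded if there is a constant $c$ with $||y|-|x||\le c$ for all $(x,y)\in J$. An Alternating Automatic Register Machine (AARM) $M=(\Gamma,\Sigma,A,B)$ consists of a register alphabet $\Gamma$, an input alphabet $\Sigma\subseteq\Gamma$ and two finite sets $A,B$ of instructions, each a bounded automatic relation $J\subseteq\Gamma^*\times\Gamma^*$. On input $w\in\Sigma^*$ the register initially contains $w$, and two players, Anke and Boris, move alternately, Anke first: on her turn, if the register contains $r$, Anke chooses $J\in A$ and some $x$ with $(r,x)\in J$, and the register then contains $x$; Boris moves in the same way using instructions from $B$.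 If the player to move has no instruction $J$ in their set with some $x$ such that $(r,x)\in J$, the game ends and the player who made the last move wins; an infinite play is a draw. $M$ accepts $w$ if Anke has a winning strategy. -}

module Defs where

open import Data.Nat using (ℕ; zero; suc; _+_; _*_; _≤_)
open import Data.Integer using (ℤ; +_; _-_; ∣_∣)
open import Data.Fin using (Fin; zero; suc)
open import Data.Bool using (Bool; true; false; if_then_else_)
open import Data.Maybe using (Maybe; just; nothing)
open import Data.List using (List; []; _∷_; foldl; length; map)
open import Data.List.Membership.Propositional using (_∈_)
open import Data.Product using (Σ; ∃; _×_; _,_)
open import Relation.Binary.PropositionalEquality using (_≡_)
open import Function using (Injective)

-- Convolution of two words (padding symbol # is `nothing`)

conv : {A : Set} → List A → List A → List (Maybe A × Maybe A)
conv []       []       = []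
conv (x ∷ xs) []       = (just x , nothing) ∷ conv xs []
conv []       (y ∷ ys) = (nothing , just y) ∷ conv [] ys
conv (x ∷ xs) (y ∷ ys) = (just x , just y) ∷ conv xs ys

record DFA (A : Set) : Set where
  field
    states : ℕ
    start  : Fin states
    δ      : Fin states → A → Fin states
    final  : Fin states → Bool

DFAAccepts : {A : Set} → DFA A → List A → Set
DFAAccepts D u = DFA.final D (foldl (DFA.δ D) (DFA.start D) u) ≡ true

-- Automatic relations over the register alphabet Γ = Fin g.
-- An automatic relation J is given by a DFA recognising
-- { conv(x,y) : (x,y) ∈ J }, so that (x,y) ∈ J iff conv(x,y) is accepted.

Word : ℕ → Set
Word g = List (Fin g)

AutoRel : ℕ → Set
AutoRel g = DFA (Maybe (Fin g) × Maybe (Fin g))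

_∋⟨_,_⟩ : {g : ℕ} → AutoRel g → Word g → Word g → Set
J ∋⟨ x , y ⟩ = DFAAccepts J (conv x y)

Bounded : {g : ℕ} → AutoRel g → Set
Bounded {g} J = Σ ℕ λ c → (x y : Word g) → J ∋⟨ x , y ⟩ →
  ∣ + length y - + length x ∣ ≤ c

-- Alternating automatic register machines.
-- Register alphabet Γ = Fin g; the input alphabet Σ ⊆ Γ is the image of
-- the injective map `digit` from binary digits (false = 0, true = 1).

record AARM : Set where
  field
    g         : ℕ
    digit     : Bool → Fin g
    digit-inj : Injective _≡_ _≡_ digit
    A         : List (AutoRel g)
    B         : List (AutoRel g)
    A-bounded : (J : AutoRel g) → J ∈ A → Bounded J
    B-bounded : (J : AutoRel g) → J ∈ B → Bounded J

-- AnkeWins M r : Anke, being to move with register content r, has a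
-- winning strategy (she can force, in finitely many rounds, a position
-- where Boris is to move and has no legal move).  Infinite plays are
-- draws, so this least fixed point is exactly "Anke has a winning strategy".
data AnkeWins (M : AARM) : Word (AARM.g M) → Set where
  move : ∀ {r} (J : AutoRel (AARM.g M)) (x : Word (AARM.g M)) →
         J ∈ AARM.A M → J ∋⟨ r , x ⟩ →
         ((J' : AutoRel (AARM.g M)) (y : Word (AARM.g M)) →
            J' ∈ AARM.B M → J' ∋⟨ x , y ⟩ → AnkeWins M y) →
         AnkeWins M r

AARMAccepts : (M : AARM) → List Bool → Set
AARMAccepts M w = AnkeWins M (map (AARM.digit M) w)

-- Binary value of a word, most significant bit first; [] represents 0.

bit : Bool → ℕ
bit b = if b then 1 else 0

binValue : List Bool → ℕ
binValue = foldl (λ acc b → 2 * acc + bit b) 0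

-- Register machines with registers R_1..R_n (Fin n, n ≥ 1 so R_1 exists)
-- and instructions I_1..I_k (Fin k, k ≥ 1, execution starts at I_1).

data Instr (n k : ℕ) : Set where
  inc  : Fin n → Fin k → Instr n k
  dec  : Fin n → Fin k → Fin k → Instr n k
  halt : Instr n k

Program : ℕ → ℕ → Set
Program n k = Fin k → Instr n k

Config : ℕ → ℕ → Set
Config n k = Fin k × (Fin n → ℕ)

update : {n : ℕ} → (Fin n → ℕ) → Fin n → ℕ → (Fin n → ℕ)
update {suc n} f zero    v zero    = v
update {suc n} f zero    v (suc j) = f (suc j)
update {suc n} f (suc i) v zero    = f zero
update {suc n} f (suc i) v (suc j) = update (λ j' → f (suc j')) i v j

-- one step; nothing = the current instruction is HALT
step : {n k : ℕ} → Program n k → Config n k → Maybe (Config n k)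
step P (pc , regs) = exec (P pc)
  where
  exec : _ → _
  exec (inc r i) = just (i , update regs r (suc (regs r)))
  exec (dec r i i') with regs r
  ... | zero  = just (i' , regs)
  ... | suc v = just (i , update regs r v)
  exec halt = nothing

haltsWithin : {n k : ℕ} → Program n k → ℕ → Config n k → Bool
haltsWithin P t c with step P c
... | nothing = true
haltsWithin P zero    c | just _  = false
haltsWithin P (suc t) c | just c' = haltsWithin P t c'

Halts : {n k : ℕ} → Program n k → Config n k → Set
Halts P c = Σ ℕ λ t → haltsWithin P t c ≡ true

initConfig : {n k : ℕ} → ℕ → Config (suc n) (suc k)
initConfig m = zero , λ { zero → m ; (suc _) → 0 }

module Submission where

-- A configuration (pc , R) of the register machine is written on the AARM
-- register as  blank^m · state pc · X,  where X holds R_i copies of the letter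
-- reg i, and every instruction of the program becomes an automatic relation
-- for Anke performing exactly that step on such words.  Boris's only
-- instruction copies the register and is legal only while no HALT state is
-- shown, so Anke wins exactly when the machine halts.  Before simulating, Anke
-- converts the binary input into the unary content of R_1, reading digits
-- most significant first: the units counted so far become carries worth two
-- units each, and every carry is later traded for two units.  Each relation
-- maps letters pointwise around a few marked positions, hence is automatic
-- and bounded; the heart of the proof is that from a valid encoding every
-- legal move of Anke yields the encoding of the intended successor, so she
-- cannot cheat, while the intended move is always available to her.

open import Defs
open import Data.Nat using (ℕ; zero; suc; _+_; _*_; _≤_; z≤n; s≤s)
open import Data.Nat.Properties using (+-suc; +-assoc; +-identityʳ; m≤m+n; m+n∸m≡n)
open import Data.Nat.Tactic.RingSolver using (solve-∀)
import Data.Integer as ℤ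
import Data.Integer.Properties as ℤ
open import Data.Fin using (Fin; zero; suc; _≟_; _↑ˡ_; _↑ʳ_; splitAt)
open import Data.Fin.Properties using (↑ˡ-injective; ↑ʳ-injective; splitAt-↑ˡ; splitAt-↑ʳ)
import Data.Fin.Properties as Fin
open import Data.Bool using (Bool; true; false; if_then_else_)
open import Data.Maybe using (Maybe; just; nothing)
open import Data.Maybe.Properties using (just-injective; ≡-dec)
open import Data.List using (List; []; _∷_; _∷ʳ_; _++_; foldl; length; map; replicate; allFin; concatMap; fromMaybe)
open import Data.List.Properties using (++-assoc; ++-identityʳ; length-++; ∷-injective)
open import Data.List.Relation.Unary.All using (All; []; _∷_)
import Data.List.Relation.Unary.All as All
open import Data.List.Relation.Unary.All.Properties using (++⁺; ++⁻ˡ; ++⁻ʳ; replicate⁺; map⁺)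
open import Data.List.Relation.Unary.Any using (here; there)
import Data.List.Relation.Unary.Any as Any
open import Data.List.Relation.Binary.Pointwise using (Pointwise; []; _∷_; Pointwise-length)
import Data.List.Relation.Binary.Pointwise as Pointwise
open import Data.List.Membership.Propositional using (_∈_; lose)
open import Data.List.Membership.Propositional.Properties using (∈-map⁺; ∈-map⁻; ∈-concatMap⁺; ∈-concatMap⁻; ∈-allFin)
open import Data.Product using (Σ; _×_; _,_; proj₁; proj₂)
open import Data.Sum using (_⊎_; inj₁; inj₂; [_,_]′)
open import Data.Empty using (⊥-elim)
open import Function using (const; _∘_)
open import Relation.Nullary using (¬_; Dec; yes; no; _×-dec_)
open import Relation.Binary.Definitions using (DecidableEquality)
open import Relation.Binary.PropositionalEquality using (_≡_; _≢_; refl; sym; trans; cong; cong₂; subst; module ≡-Reasoning)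

module _ {A : Set} where

  ∉-split : ∀ {a : A} {P X₁ X₂ T} → All (a ≢_) P → X₁ ++ a ∷ X₂ ≡ P ++ T →
            Σ (List A) λ T₁ → X₁ ≡ P ++ T₁ × T ≡ T₁ ++ a ∷ X₂
  ∉-split {X₁ = X₁} [] eq = X₁ , refl , sym eq
  ∉-split {X₁ = []}     (a≢p ∷ _) eq = ⊥-elim (a≢p (proj₁ (∷-injective eq)))
  ∉-split {X₁ = x ∷ X₁} (_ ∷ ∉P) eq with ∷-injective eq
  ... | refl , eq' with ∉-split ∉P eq'
  ...   | T₁ , refl , T≡ = T₁ , refl , T≡

  replicate-split : ∀ {z a c : A} {X₁ X₂ Z} m → All (_≡ z) X₁ → a ≢ z → c ≢ z →
                    X₁ ++ a ∷ X₂ ≡ replicate m z ++ c ∷ Z → X₁ ≡ replicate m z × a ≡ c × X₂ ≡ Z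
  replicate-split {X₁ = []}     zero    []        a≢z c≢z eq = refl , ∷-injective eq
  replicate-split {X₁ = _ ∷ _}  zero    (x≡z ∷ _) a≢z c≢z eq =
    ⊥-elim (c≢z (trans (sym (proj₁ (∷-injective eq))) x≡z))
  replicate-split {X₁ = []}     (suc m) []        a≢z c≢z eq = ⊥-elim (a≢z (proj₁ (∷-injective eq)))
  replicate-split {X₁ = x ∷ X₁} (suc m) (x≡z ∷ zs) a≢z c≢z eq
    with replicate-split m zs a≢z c≢z (proj₂ (∷-injective eq))
  ... | X₁≡ , a≡c , X₂≡ = cong₂ _∷_ x≡z X₁≡ , a≡c , X₂≡

module _ {A : Set} {R : A → A → Set} where

  pointwise-identity : (∀ {x y} → R x y → y ≡ x) → ∀ {X Y} → Pointwise R X Y → Y ≡ X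
  pointwise-identity R⇒≡ = sym ∘ Pointwise.Pointwise-≡⇒≡ ∘ Pointwise.map (sym ∘ R⇒≡)

  pointwise⇒All : ∀ {Q : A → Set} → (∀ {x y} → R x y → Q x) → ∀ {X Y} → Pointwise R X Y → All Q X
  pointwise⇒All R⇒Q []       = []
  pointwise⇒All R⇒Q (r ∷ rs) = R⇒Q r ∷ pointwise⇒All R⇒Q rs

  pointwise-++⁻ : ∀ X₁ {X₂ Y} → Pointwise R (X₁ ++ X₂) Y →
                  Σ (List A) λ Y₁ → Σ (List A) λ Y₂ → Y ≡ Y₁ ++ Y₂ × Pointwise R X₁ Y₁ × Pointwise R X₂ Y₂
  pointwise-++⁻ []       rs       = [] , _ , refl , [] , rs
  pointwise-++⁻ (x ∷ X₁) (r ∷ rs) with pointwise-++⁻ X₁ rs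
  ... | Y₁ , Y₂ , refl , rs₁ , rs₂ = _ ∷ Y₁ , Y₂ , refl , r ∷ rs₁ , rs₂

module Count {A : Set} (_≟_ : DecidableEquality A) where

  count : A → List A → ℕ
  count a [] = 0
  count a (x ∷ xs) with a ≟ x
  ... | yes _ = suc (count a xs)
  ... | no  _ = count a xs

  count-++ : ∀ a xs ys → count a (xs ++ ys) ≡ count a xs + count a ys
  count-++ a []       ys = refl
  count-++ a (x ∷ xs) ys with a ≟ x
  ... | yes _ = cong suc (count-++ a xs ys)
  ... | no  _ = count-++ a xs ys

  count-∷-≡ : ∀ a xs → count a (a ∷ xs) ≡ suc (count a xs)
  count-∷-≡ a xs with a ≟ a
  ... | yes _  = refl
  ... | no a≢a = ⊥-elim (a≢a refl)

  count-∷-≢ : ∀ {a x} xs → a ≢ x → count a (x ∷ xs) ≡ count a xs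
  count-∷-≢ {a} {x} xs a≢x with a ≟ x
  ... | yes a≡x = ⊥-elim (a≢x a≡x)
  ... | no  _   = refl

  count-middle-≡ : ∀ a xs ys → count a (xs ++ a ∷ ys) ≡ suc (count a xs + count a ys)
  count-middle-≡ a xs ys
    rewrite count-++ a xs (a ∷ ys) | count-∷-≡ a ys = +-suc (count a xs) (count a ys)

  count-middle-≢ : ∀ {a b} xs ys → a ≢ b → count a (xs ++ b ∷ ys) ≡ count a xs + count a ys
  count-middle-≢ {a} {b} xs ys a≢b rewrite count-++ a xs (b ∷ ys) | count-∷-≢ ys a≢b = refl

  ∉⇒count≡0 : ∀ {a xs} → All (a ≢_) xs → count a xs ≡ 0
  ∉⇒count≡0 []            = refl
  ∉⇒count≡0 (a≢x ∷ a∉xs) = trans (count-∷-≢ _ a≢x) (∉⇒count≡0 a∉xs)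

  count≡0⇒∉ : ∀ a xs → count a xs ≡ 0 → All (a ≢_) xs
  count≡0⇒∉ a []       _ = []
  count≡0⇒∉ a (x ∷ xs) c≡0 with a ≟ x
  ... | no  a≢x = a≢x ∷ count≡0⇒∉ a xs c≡0

  count-all : ∀ {a xs} → All (_≡ a) xs → count a xs ≡ length xs
  count-all {xs = []}     []          = refl
  count-all {xs = x ∷ xs} (refl ∷ as) = trans (count-∷-≡ x xs) (cong suc (count-all as))

  count≡suc⇒split : ∀ a xs {v} → count a xs ≡ suc v →
                    Σ (List A) λ xs₁ → Σ (List A) λ xs₂ → xs ≡ xs₁ ++ a ∷ xs₂ × All (a ≢_) xs₁
  count≡suc⇒split a []       ()
  count≡suc⇒split a (x ∷ xs) c≡ with a ≟ x
  ... | yes refl = [] , xs , refl , []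
  ... | no  a≢x with count≡suc⇒split a xs c≡
  ...   | xs₁ , xs₂ , refl , a∉xs₁ = x ∷ xs₁ , xs₂ , refl , a≢x ∷ a∉xs₁

  count-∷ʳ-≡ : ∀ a xs → count a (xs ∷ʳ a) ≡ suc (count a xs)
  count-∷ʳ-≡ a xs = trans (count-middle-≡ a xs []) (cong suc (+-identityʳ (count a xs)))

  count-∷ʳ-≢ : ∀ {a b} xs → a ≢ b → count a (xs ∷ʳ b) ≡ count a xs
  count-∷ʳ-≢ xs a≢b = trans (count-middle-≢ xs [] a≢b) (+-identityʳ _)

branch : ∀ {p} {P : Set p} {A : Set} → Dec P → A → A → A
branch (yes _) t e = t
branch (no _)  t e = e

branch-cases : ∀ {p} {P : Set p} {A : Set} (d : Dec P) (t e : A) →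
               (P × branch d t e ≡ t) ⊎ (¬ P × branch d t e ≡ e)
branch-cases (yes p) t e = inj₁ (p , refl)
branch-cases (no ¬p) t e = inj₂ (¬p , refl)

branch-yes : ∀ {p} {P : Set p} {A : Set} (d : Dec P) {t e : A} → P → branch d t e ≡ t
branch-yes (yes _) p = refl
branch-yes (no ¬p) p = ⊥-elim (¬p p)

branch-no : ∀ {p} {P : Set p} {A : Set} (d : Dec P) {t e : A} → ¬ P → branch d t e ≡ e
branch-no (yes p) ¬p = ⊥-elim (¬p p)
branch-no (no _)  ¬p = refl

module LetterwiseRelation (g : ℕ) where

  Letter : Set
  Letter = Fin g

  LetterMap : Set
  LetterMap = Letter → Maybe Letter

  Pair : Set
  Pair = Maybe Letter × Maybe Letter

  _≟ᴹ_ : DecidableEquality (Maybe Letter)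
  _≟ᴹ_ = ≡-dec _≟_

  data Spec : Set where
    pointwise : LetterMap → Maybe Letter → Spec
    until     : LetterMap → Letter → Letter → Spec → Spec

  Maps : LetterMap → Letter → Letter → Set
  Maps f x y = f x ≡ just y

  -- The prefix of an until-relation never shows the pair (a , b), so its
  -- automaton knows deterministically where the prefix ends.
  MapsAvoiding : LetterMap → Letter → Letter → Letter → Letter → Set
  MapsAvoiding f a b x y = Maps f x y × ¬ (x ≡ a × y ≡ b)

  data ⟦_⟧ : Spec → Word g → Word g → Set where
    maps   : ∀ {f e X Y} Y₁ → Pointwise (Maps f) X Y₁ → Y ≡ Y₁ ++ fromMaybe e → ⟦ pointwise f e ⟧ X Y
    splits : ∀ {f a b S X Y} X₁ X₂ Y₁ Y₂ → X ≡ X₁ ++ a ∷ X₂ → Y ≡ Y₁ ++ b ∷ Y₂ →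
             Pointwise (MapsAvoiding f a b) X₁ Y₁ → ⟦ S ⟧ X₂ Y₂ → ⟦ until f a b S ⟧ X Y

  size : Spec → ℕ
  size (pointwise _ _) = 3
  size (until _ _ _ S) = suc (size S)

  start sink : (S : Spec) → Fin (size S)
  start (pointwise _ _) = zero
  start (until _ _ _ _) = zero
  sink  (pointwise _ _) = suc (suc zero)
  sink  (until _ _ _ S) = suc (sink S)

  -- For pointwise f e, state 0 reads letter pairs and state 1 has read the
  -- appended letter e; for until f a b S, state 0 reads the prefix and
  -- state suc q is state q of the automaton of S.
  δ : (S : Spec) → Fin (size S) → Pair → Fin (size S)
  δ (pointwise f e) zero (just x  , just y) = branch (f x ≟ᴹ just y) zero (sink (pointwise f e))
  δ (pointwise f e) zero (nothing , just y) = branch (e ≟ᴹ just y) (suc zero) (sink (pointwise f e))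
  δ (pointwise f e) zero (_ , nothing)      = sink (pointwise f e)
  δ (pointwise f e) (suc _) _               = sink (pointwise f e)
  δ (until f a b S) zero (just x , just y)  =
    branch ((x ≟ a) ×-dec (y ≟ b)) (suc (start S)) (branch (f x ≟ᴹ just y) zero (sink (until f a b S)))
  δ (until f a b S) zero _                  = sink (until f a b S)
  δ (until f a b S) (suc q) p               = suc (δ S q p)

  final : (S : Spec) → Fin (size S) → Bool
  final (pointwise f nothing)  zero          = true
  final (pointwise f (just _)) zero          = false
  final (pointwise f e)        (suc zero)    = true
  final (pointwise f e)        (suc (suc _)) = false
  final (until _ _ _ S)        zero          = false
  final (until _ _ _ S)        (suc q)       = final S q

  toDFA : Spec → AutoRel g
  toDFA S = record { states = size S ; start = start S ; δ = δ S ; final = final S }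

  Accepts : (S : Spec) → Fin (size S) → List Pair → Set
  Accepts S q u = final S (foldl (δ S) q u) ≡ true

  moves-to : ∀ S u {q q'} → q ≡ q' → Accepts S q u → Accepts S q' u
  moves-to S u refl acc = acc

  δ-sink : ∀ S p → δ S (sink S) p ≡ sink S
  δ-sink (pointwise f e) p = refl
  δ-sink (until f a b S) p = cong suc (δ-sink S p)

  final-sink : ∀ S → final S (sink S) ≡ false
  final-sink (pointwise f nothing)  = refl
  final-sink (pointwise f (just _)) = refl
  final-sink (until f a b S)        = final-sink S

  foldl-sink : ∀ S u → foldl (δ S) (sink S) u ≡ sink S
  foldl-sink S []      = refl
  foldl-sink S (p ∷ u) rewrite δ-sink S p = foldl-sink S u

  rejects : ∀ S u {q} → q ≡ sink S → ¬ Accepts S q u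
  rejects S u refl acc with trans (sym acc) (trans (cong (final S) (foldl-sink S u)) (final-sink S))
  ... | ()

  foldl-until-inner : ∀ f a b S q u → foldl (δ (until f a b S)) (suc q) u ≡ suc (foldl (δ S) q u)
  foldl-until-inner f a b S q []      = refl
  foldl-until-inner f a b S q (p ∷ u) = foldl-until-inner f a b S (δ S q p) u

  accepts-until-inner : ∀ f a b S q u → Accepts (until f a b S) (suc q) u → Accepts S q u
  accepts-until-inner f a b S q u = trans (cong (final (until f a b S)) (sym (foldl-until-inner f a b S q u)))

  inner-accepts-until : ∀ f a b S q u → Accepts S q u → Accepts (until f a b S) (suc q) u
  inner-accepts-until f a b S q u = trans (cong (final (until f a b S)) (foldl-until-inner f a b S q u))

  accepts⇒pointwise : ∀ f e X Y → Accepts (pointwise f e) zero (conv X Y) → ⟦ pointwise f e ⟧ X Y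
  accepts⇒pointwise f nothing  [] [] acc = maps [] [] refl
  accepts⇒pointwise f (just _) [] [] ()
  accepts⇒pointwise f e [] (y ∷ Y) acc with branch-cases (e ≟ᴹ just y) (suc zero) (sink (pointwise f e)) | Y
  ... | inj₁ (refl , _) | []      = maps [] [] refl
  ... | inj₁ (_ , q≡)   | y' ∷ Y' =
    ⊥-elim (rejects (pointwise f e) (conv [] Y') refl (moves-to (pointwise f e) (conv [] (y' ∷ Y')) q≡ acc))
  ... | inj₂ (_ , q≡)   | Y'      = ⊥-elim (rejects (pointwise f e) (conv [] Y') q≡ acc)
  accepts⇒pointwise f e (x ∷ X) [] acc = ⊥-elim (rejects (pointwise f e) (conv X []) refl acc)
  accepts⇒pointwise f e (x ∷ X) (y ∷ Y) acc with branch-cases (f x ≟ᴹ just y) zero (sink (pointwise f e))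
  ... | inj₂ (_ , q≡) = ⊥-elim (rejects (pointwise f e) (conv X Y) q≡ acc)
  ... | inj₁ (fx≡y , q≡) with accepts⇒pointwise f e X Y (moves-to (pointwise f e) (conv X Y) q≡ acc)
  ...   | maps Y₁ Y₁≈ refl = maps (y ∷ Y₁) (fx≡y ∷ Y₁≈) refl

  accepts⇒⟦⟧ : ∀ S X Y → Accepts S (start S) (conv X Y) → ⟦ S ⟧ X Y
  accepts⇒⟦⟧ (pointwise f e) X Y acc = accepts⇒pointwise f e X Y acc
  accepts⇒⟦⟧ (until f a b S) [] []      ()
  accepts⇒⟦⟧ (until f a b S) [] (y ∷ Y) acc = ⊥-elim (rejects (until f a b S) (conv [] Y) refl acc)
  accepts⇒⟦⟧ (until f a b S) (x ∷ X) [] acc = ⊥-elim (rejects (until f a b S) (conv X []) refl acc)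
  accepts⇒⟦⟧ (until f a b S) (x ∷ X) (y ∷ Y) acc
    with branch-cases ((x ≟ a) ×-dec (y ≟ b)) (suc (start S)) (branch (f x ≟ᴹ just y) zero (sink (until f a b S)))
  ... | inj₁ ((refl , refl) , q≡) =
    splits [] X [] Y refl refl []
      (accepts⇒⟦⟧ S X Y (accepts-until-inner f a b S (start S) (conv X Y) (moves-to (until f a b S) (conv X Y) q≡ acc)))
  ... | inj₂ (≢ab , q≡) with branch-cases (f x ≟ᴹ just y) zero (sink (until f a b S))
  ...   | inj₂ (_ , q≡') = ⊥-elim (rejects (until f a b S) (conv X Y) (trans q≡ q≡') acc)
  ...   | inj₁ (fx≡y , q≡')
    with accepts⇒⟦⟧ (until f a b S) X Y (moves-to (until f a b S) (conv X Y) (trans q≡ q≡') acc)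
  ...     | splits X₁ X₂ Y₁ Y₂ refl refl pre rest =
    splits (x ∷ X₁) X₂ (y ∷ Y₁) Y₂ refl refl ((fx≡y , ≢ab) ∷ pre) rest

  pointwise⇒accepts : ∀ f e X Y₁ → Pointwise (Maps f) X Y₁ → Accepts (pointwise f e) zero (conv X (Y₁ ++ fromMaybe e))
  pointwise⇒accepts f nothing  [] [] [] = refl
  pointwise⇒accepts f (just y) [] [] [] rewrite branch-yes (just y ≟ᴹ just y) {suc zero} {sink (pointwise f (just y))} refl = refl
  pointwise⇒accepts f e (x ∷ X) (y ∷ Y₁) (fx≡y ∷ Y₁≈) =
    moves-to (pointwise f e) (conv X (Y₁ ++ fromMaybe e)) (sym (branch-yes (f x ≟ᴹ just y) fx≡y))
      (pointwise⇒accepts f e X Y₁ Y₁≈)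

  ⟦⟧⇒accepts : ∀ S X Y → ⟦ S ⟧ X Y → Accepts S (start S) (conv X Y)
  until⇒accepts : ∀ f a b S X₁ X₂ Y₁ Y₂ → Pointwise (MapsAvoiding f a b) X₁ Y₁ → ⟦ S ⟧ X₂ Y₂ →
                  Accepts (until f a b S) zero (conv (X₁ ++ a ∷ X₂) (Y₁ ++ b ∷ Y₂))
  until⇒accepts f a b S [] X₂ [] Y₂ [] rest =
    moves-to (until f a b S) (conv X₂ Y₂) (sym (branch-yes ((a ≟ a) ×-dec (b ≟ b)) (refl , refl)))
      (inner-accepts-until f a b S (start S) (conv X₂ Y₂) (⟦⟧⇒accepts S X₂ Y₂ rest))
  until⇒accepts f a b S (x ∷ X₁) X₂ (y ∷ Y₁) Y₂ ((fx≡y , ≢ab) ∷ pre) rest =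
    moves-to (until f a b S) (conv (X₁ ++ a ∷ X₂) (Y₁ ++ b ∷ Y₂))
      (sym (trans (branch-no ((x ≟ a) ×-dec (y ≟ b)) ≢ab) (branch-yes (f x ≟ᴹ just y) fx≡y)))
      (until⇒accepts f a b S X₁ X₂ Y₁ Y₂ pre rest)

  ⟦⟧⇒accepts (pointwise f e) X Y (maps Y₁ Y₁≈ refl) = pointwise⇒accepts f e X Y₁ Y₁≈
  ⟦⟧⇒accepts (until f a b S) X Y (splits X₁ X₂ Y₁ Y₂ refl refl pre rest) =
    until⇒accepts f a b S X₁ X₂ Y₁ Y₂ pre rest

  growth : Spec → ℕ
  growth (pointwise _ e) = length (fromMaybe e)
  growth (until _ _ _ S) = growth S

  growth≤1 : ∀ S → growth S ≤ 1
  growth≤1 (pointwise _ nothing)  = z≤n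
  growth≤1 (pointwise _ (just _)) = s≤s z≤n
  growth≤1 (until _ _ _ S)        = growth≤1 S

  ⟦⟧-length : ∀ S X Y → ⟦ S ⟧ X Y → length Y ≡ length X + growth S
  ⟦⟧-length (pointwise f e) X Y (maps Y₁ Y₁≈ refl)
    rewrite length-++ Y₁ {fromMaybe e} | Pointwise-length Y₁≈ = refl
  ⟦⟧-length (until f a b S) X Y (splits X₁ X₂ Y₁ Y₂ refl refl pre rest)
    rewrite length-++ Y₁ {b ∷ Y₂} | length-++ X₁ {a ∷ X₂} | Pointwise-length pre | ⟦⟧-length S X₂ Y₂ rest
    = sym (+-assoc (length Y₁) (suc (length X₂)) (growth S))

  ∣m+n-m∣≡n : ∀ m n → ℤ.∣ ℤ.+ (m + n) ℤ.- ℤ.+ m ∣ ≡ n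
  ∣m+n-m∣≡n m n rewrite ℤ.m-n≡m⊖n (m + n) m | ℤ.⊖-≥ (m≤m+n m n) | m+n∸m≡n m n = refl

  toDFA-bounded : ∀ S → Bounded (toDFA S)
  toDFA-bounded S = 1 , λ X Y acc →
    subst (_≤ 1) (sym (trans (cong (λ l → ℤ.∣ ℤ.+ l ℤ.- ℤ.+ length X ∣) (⟦⟧-length S X Y (accepts⇒⟦⟧ S X Y acc)))
                             (∣m+n-m∣≡n (length X) (growth S))))
          (growth≤1 S)

  ⟦pointwise-just⟧ : ∀ {e X Y} → ⟦ pointwise just e ⟧ X Y → Y ≡ X ++ fromMaybe e
  ⟦pointwise-just⟧ {e} (maps Y₁ Y₁≈ refl) = cong (_++ fromMaybe e) (pointwise-identity (λ { refl → refl }) Y₁≈)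

  pointwise-just-⟦⟧ : ∀ e X → ⟦ pointwise just e ⟧ X (X ++ fromMaybe e)
  pointwise-just-⟦⟧ e X = maps X (Pointwise.refl refl) refl

  until-nonempty : ∀ {f a b S y} → ¬ ⟦ until f a b S ⟧ [] y
  until-nonempty (splits []      _ _ _ () _ _ _)
  until-nonempty (splits (_ ∷ _) _ _ _ () _ _ _)

module _ {n k : ℕ} (P : Program n k) where

  data Halting : Config n k → Set where
    stop : ∀ {c} → step P c ≡ nothing → Halting c
    next : ∀ {c c'} → step P c ≡ just c' → Halting c' → Halting c

  haltsWithin⇒Halting : ∀ t c → haltsWithin P t c ≡ true → Halting c
  haltsWithin⇒Halting t c h with step P c in eq
  haltsWithin⇒Halting t       c h | nothing = stop eq
  haltsWithin⇒Halting (suc t) c h | just c' = next eq (haltsWithin⇒Halting t c' h)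

  Halts⇒Halting : ∀ {c} → Halts P c → Halting c
  Halts⇒Halting (t , h) = haltsWithin⇒Halting t _ h

  Halting⇒Halts : ∀ {c} → Halting c → Halts P c
  Halting⇒Halts {c} (stop eq) = zero , now
    where now : haltsWithin P zero c ≡ true
          now rewrite eq = refl
  Halting⇒Halts {c} (next eq h) with Halting⇒Halts h
  ... | t , h' = suc t , later
    where later : haltsWithin P (suc t) c ≡ true
          later rewrite eq = h'

module Simulation (n k : ℕ) (P : Program (suc n) (suc k)) where

  N K : ℕ
  N = suc n
  K = suc k

  #letters : ℕ
  #letters = 4 + (N + K)

  open LetterwiseRelation #letters
  open Count (_≟_ {#letters})

  dig : Bool → Letter
  dig false = zero
  dig true  = suc zero

  blank carry : Letter
  blank = suc (suc zero)
  carry = suc (suc (suc zero))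

  reg : Fin N → Letter
  reg i = suc (suc (suc (suc (i ↑ˡ K))))

  state : Fin K → Letter
  state p = suc (suc (suc (suc (N ↑ʳ p))))

  -- The unary counter of the conversion phase uses the letter of R_1, so the
  -- converted input is already the content of R_1.
  unit : Letter
  unit = reg zero

  blanks : ℕ → Word #letters
  blanks m = replicate m blank

  dig-injective : ∀ {b b'} → dig b ≡ dig b' → b ≡ b'
  dig-injective {false} {false} _ = refl
  dig-injective {true}  {true}  _ = refl

  dig≢blank : ∀ b → dig b ≢ blank
  dig≢blank false ()
  dig≢blank true  ()

  state≢blank : ∀ p → state p ≢ blank
  state≢blank p ()

  dig≢state : ∀ b p → dig b ≢ state p
  dig≢state false p ()
  dig≢state true  p ()

  reg-injective : ∀ {i j} → reg i ≡ reg j → i ≡ j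
  reg-injective {i} {j} e = ↑ˡ-injective K i j (Fin.suc-injective (Fin.suc-injective (Fin.suc-injective (Fin.suc-injective e))))

  state-injective : ∀ {p q} → state p ≡ state q → p ≡ q
  state-injective {p} {q} e = ↑ʳ-injective N p q (Fin.suc-injective (Fin.suc-injective (Fin.suc-injective (Fin.suc-injective e))))

  isHalt : Instr N K → Bool
  isHalt halt = true
  isHalt _    = false

  halting : Letter → Bool
  halting (suc (suc (suc (suc c)))) = [ const false , isHalt ∘ P ]′ (splitAt N c)
  halting _                         = false

  halting-reg : ∀ i → halting (reg i) ≡ false
  halting-reg i rewrite splitAt-↑ˡ N i K = refl

  halting-state : ∀ p → halting (state p) ≡ isHalt (P p)
  halting-state p rewrite splitAt-↑ʳ N K p = refl

  HaltFree : Word #letters → Set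
  HaltFree = All (λ c → halting c ≡ false)

  data IsCell : Letter → Set where
    blank-cell : IsCell blank
    reg-cell   : ∀ i → IsCell (reg i)

  data IsCounter : Letter → Set where
    carry-counter : IsCounter carry
    unit-counter  : IsCounter unit

  mark : Bool → Letter → Maybe Letter
  mark b c = if b then just c else nothing

  mark-all : ∀ b c → All (_≡ c) (fromMaybe (mark b c))
  mark-all false c = []
  mark-all true  c = refl ∷ []

  erase keepBlanks carryUnits keepUnits keepRunning : LetterMap
  erase _ = nothing
  keepBlanks (suc (suc zero)) = just blank
  keepBlanks _                = nothing
  carryUnits zero                          = just zero
  carryUnits (suc zero)                    = just (suc zero)
  carryUnits (suc (suc (suc (suc zero)))) = just carry
  carryUnits _                             = nothing
  keepUnits (suc (suc (suc (suc zero)))) = just unit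
  keepUnits _                             = nothing
  keepRunning x = if halting x then nothing else just x

  keepAllBut : Fin N → LetterMap
  keepAllBut r x with reg r ≟ x
  ... | yes _ = nothing
  ... | no  _ = just x

  keepBlanks-inv : ∀ {x y} → keepBlanks x ≡ just y → x ≡ blank × y ≡ blank
  keepBlanks-inv {suc (suc zero)} refl = refl , refl

  keepAllBut-inv : ∀ {r x y} → keepAllBut r x ≡ just y → y ≡ x × reg r ≢ x
  keepAllBut-inv {r} {x} e with reg r ≟ x
  keepAllBut-inv refl | no r≢x = refl , r≢x

  keepAllBut-≢ : ∀ {r x} → reg r ≢ x → keepAllBut r x ≡ just x
  keepAllBut-≢ {r} {x} r≢x with reg r ≟ x
  ... | yes r≡x = ⊥-elim (r≢x r≡x)
  ... | no  _   = refl

  keepRunning-inv : ∀ {x y} → keepRunning x ≡ just y → y ≡ x × halting x ≡ false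
  keepRunning-inv {x} e with halting x
  keepRunning-inv refl | false = refl , refl

  keepRunning-running : ∀ {x} → halting x ≡ false → keepRunning x ≡ just x
  keepRunning-running h rewrite h = refl

  carryUnits-dig : ∀ {b y} → carryUnits (dig b) ≡ just y → y ≡ dig b
  carryUnits-dig {false} refl = refl
  carryUnits-dig {true}  refl = refl

  carryUnits-counter : ∀ {x y} → IsCounter x → carryUnits x ≡ just y → x ≡ unit × y ≡ carry
  carryUnits-counter unit-counter refl = refl , refl

  keepUnits-counter : ∀ {x y} → IsCounter x → keepUnits x ≡ just y → x ≡ unit × y ≡ x
  keepUnits-counter unit-counter refl = refl , refl

  keepUnits-dig : ∀ {b y} → keepUnits (dig b) ≢ just y
  keepUnits-dig {false} ()
  keepUnits-dig {true}  ()

  doubling : Spec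
  doubling = until just carry unit (pointwise just (just unit))

  -- The inner until with the empty map erase forces the next letter to be the
  -- digit b', so reading is impossible once only the last digit remains.
  reading : Bool → Bool → Spec
  reading b b' = until keepBlanks (dig b) blank (until erase (dig b') (dig b') (pointwise carryUnits (mark b carry)))

  reading-last : Bool → Spec
  reading-last b = until keepBlanks (dig b) (state zero) (pointwise keepUnits (mark b unit))

  starting : Spec
  starting = pointwise erase (just (state zero))

  atState : Fin K → Fin K → Spec → Spec
  atState p i = until keepBlanks (state p) (state i)

  incBody decBody zeroBody : Fin N → Spec
  incBody r  = pointwise just (just (reg r))
  decBody r  = until (keepAllBut r) (reg r) blank (pointwise just nothing)
  zeroBody r = pointwise (keepAllBut r) nothing

  instrSpecs : Fin K → Instr N K → List Spec
  instrSpecs p (inc r i)    = atState p i (incBody r) ∷ []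
  instrSpecs p (dec r i i') = atState p i (decBody r) ∷ atState p i' (zeroBody r) ∷ []
  instrSpecs p halt         = []

  ankeSpecs : List Spec
  ankeSpecs = doubling ∷ starting ∷ reading-last false ∷ reading-last true ∷
              reading false false ∷ reading false true ∷ reading true false ∷ reading true true ∷
              concatMap (λ p → instrSpecs p (P p)) (allFin K)

  passing : Spec
  passing = pointwise keepRunning nothing

  M : AARM
  M = record
    { g = #letters ; digit = dig ; digit-inj = dig-injective
    ; A = map toDFA ankeSpecs ; B = toDFA passing ∷ []
    ; A-bounded = A-bounded ; B-bounded = λ { _ (here refl) → toDFA-bounded passing } }
    where
    A-bounded : ∀ J → J ∈ map toDFA ankeSpecs → Bounded J
    A-bounded J J∈ with ∈-map⁻ toDFA {xs = ankeSpecs} J∈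
    ... | S , _ , refl = toDFA-bounded S

  data Role : Spec → Set where
    double      : Role doubling
    read        : ∀ b b' → Role (reading b b')
    read-last   : ∀ b → Role (reading-last b)
    start-empty : Role starting
    increment   : ∀ {p r i} → P p ≡ inc r i → Role (atState p i (incBody r))
    decrement   : ∀ {p r i i'} → P p ≡ dec r i i' → Role (atState p i (decBody r))
    test-zero   : ∀ {p r i i'} → P p ≡ dec r i i' → Role (atState p i' (zeroBody r))

  instr-role : ∀ {p S} ins → P p ≡ ins → S ∈ instrSpecs p ins → Role S
  instr-role (inc r i)    e (here refl)         = increment e
  instr-role (dec r i i') e (here refl)         = decrement e
  instr-role (dec r i i') e (there (here refl)) = test-zero e

  ∈⇒role : ∀ {S} → S ∈ ankeSpecs → Role S
  ∈⇒role (here refl) = double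
  ∈⇒role (there (here refl)) = start-empty
  ∈⇒role (there (there (here refl))) = read-last false
  ∈⇒role (there (there (there (here refl)))) = read-last true
  ∈⇒role (there (there (there (there (here refl))))) = read false false
  ∈⇒role (there (there (there (there (there (here refl)))))) = read false true
  ∈⇒role (there (there (there (there (there (there (here refl))))))) = read true false
  ∈⇒role (there (there (there (there (there (there (there (here refl)))))))) = read true true
  ∈⇒role (there (there (there (there (there (there (there (there S∈))))))))
    with Any.satisfied (∈-concatMap⁻ _ {xs = allFin K} S∈)
  ... | p , S∈p = instr-role (P p) refl S∈p

  instr-∈ : ∀ {p S} ins → P p ≡ ins → S ∈ instrSpecs p ins → S ∈ ankeSpecs
  instr-∈ {p} ins refl S∈ =
    there (there (there (there (there (there (there (there (∈-concatMap⁺ _ {xs = allFin K} (lose (∈-allFin p) S∈)))))))))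

  role⇒∈ : ∀ {S} → Role S → S ∈ ankeSpecs
  role⇒∈ double            = here refl
  role⇒∈ start-empty       = there (here refl)
  role⇒∈ (read-last false) = there (there (here refl))
  role⇒∈ (read-last true)  = there (there (there (here refl)))
  role⇒∈ (read false false) = there (there (there (there (here refl))))
  role⇒∈ (read false true)  = there (there (there (there (there (here refl)))))
  role⇒∈ (read true false)  = there (there (there (there (there (there (here refl))))))
  role⇒∈ (read true true)   = there (there (there (there (there (there (there (here refl)))))))
  role⇒∈ (increment e) = instr-∈ _ e (here refl)
  role⇒∈ (decrement e) = instr-∈ _ e (here refl)
  role⇒∈ (test-zero e) = instr-∈ _ e (there (here refl))

  keepBlanks-prefix : ∀ {a c X Y} → Pointwise (MapsAvoiding keepBlanks a c) X Y → All (_≡ blank) X × Y ≡ X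
  keepBlanks-prefix rs = pointwise⇒All (λ r → proj₁ (keepBlanks-inv (proj₁ r))) rs ,
                         pointwise-identity (λ r → let x≡ , y≡ = keepBlanks-inv (proj₁ r) in trans y≡ (sym x≡)) rs

  blanks-avoid : ∀ {a c} m → a ≢ blank → Pointwise (MapsAvoiding keepBlanks a c) (blanks m) (blanks m)
  blanks-avoid zero    a≢ = []
  blanks-avoid (suc m) a≢ = (refl , λ { (blank≡a , _) → a≢ (sym blank≡a) }) ∷ blanks-avoid m a≢

  blanks-snoc : ∀ m Z → blanks m ++ blank ∷ Z ≡ blanks (suc m) ++ Z
  blanks-snoc zero    Z = refl
  blanks-snoc (suc m) Z = cong (blank ∷_) (blanks-snoc m Z)

  until-blanks : ∀ {a a' c S m rest y} → a ≢ blank → a' ≢ blank →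
                 ⟦ until keepBlanks a c S ⟧ (blanks m ++ a' ∷ rest) y →
                 a ≡ a' × Σ (Word #letters) λ Y₂ → y ≡ blanks m ++ c ∷ Y₂ × ⟦ S ⟧ rest Y₂
  until-blanks {m = m} a≢ a'≢ (splits X₁ X₂ Y₁ Y₂ x≡ refl pre rest) with keepBlanks-prefix pre
  ... | X₁-blank , refl with replicate-split m X₁-blank a≢ a'≢ (sym x≡)
  ...   | refl , refl , refl = refl , Y₂ , refl , rest

  until-blanks-mismatch : ∀ {a a' c S m rest y} → a ≢ blank → a' ≢ blank → a ≢ a' →
                          ¬ ⟦ until keepBlanks a c S ⟧ (blanks m ++ a' ∷ rest) y
  until-blanks-mismatch a≢ a'≢ a≢a' rel = a≢a' (proj₁ (until-blanks a≢ a'≢ rel))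

  until-blanks-⟦⟧ : ∀ {a c S X Y} m → a ≢ blank → ⟦ S ⟧ X Y →
                    ⟦ until keepBlanks a c S ⟧ (blanks m ++ a ∷ X) (blanks m ++ c ∷ Y)
  until-blanks-⟦⟧ {X = X} {Y} m a≢ rel = splits (blanks m) X (blanks m) Y refl refl (blanks-avoid m a≢) rel

  AnkeMove : Word #letters → Word #letters → Set
  AnkeMove x y = Σ Spec λ S → Role S × ⟦ S ⟧ x y

  -- Boris can only pass, and only on halt-free registers, so the AARM game
  -- reduces to this one-player game.
  data Wins : Word #letters → Set where
    play : ∀ {x y} → AnkeMove x y → (HaltFree y → Wins y) → Wins x

  passing-⟦⟧ : ∀ {y y'} → ⟦ passing ⟧ y y' → y' ≡ y × HaltFree y
  passing-⟦⟧ (maps Y₁ Y₁≈ refl) =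
    trans (++-identityʳ Y₁) (pointwise-identity (proj₁ ∘ keepRunning-inv) Y₁≈) ,
    pointwise⇒All (proj₂ ∘ keepRunning-inv) Y₁≈

  haltFree-passing : ∀ {y} → HaltFree y → ⟦ passing ⟧ y y
  haltFree-passing {y} hf = maps y (go hf) (sym (++-identityʳ y))
    where
    go : ∀ {y} → HaltFree y → Pointwise (Maps keepRunning) y y
    go []       = []
    go (h ∷ hs) = keepRunning-running h ∷ go hs

  AnkeWins⇒Wins : ∀ {x} → AnkeWins M x → Wins x
  AnkeWins⇒Wins {x} (move J y J∈A acc reply) with ∈-map⁻ toDFA {xs = ankeSpecs} J∈A
  ... | S , S∈ , refl = play (S , ∈⇒role S∈ , accepts⇒⟦⟧ S x y acc) λ hf →
    AnkeWins⇒Wins (reply (toDFA passing) y (here refl) (⟦⟧⇒accepts passing y y (haltFree-passing hf)))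

  Wins⇒AnkeWins : ∀ {x} → Wins x → AnkeWins M x
  Wins⇒AnkeWins {x} (play {y = y} (S , role , rel) k) =
    move (toDFA S) y (∈-map⁺ toDFA (role⇒∈ role)) (⟦⟧⇒accepts S x y rel) reply
    where
    reply : ∀ J y' → J ∈ AARM.B M → J ∋⟨ y , y' ⟩ → AnkeWins M y'
    reply J y' (here refl) acc with passing-⟦⟧ (accepts⇒⟦⟧ passing y y' acc)
    ... | refl , hf = Wins⇒AnkeWins (k hf)

  -- Simulation phase

  update-≡ : ∀ {m} (f : Fin m → ℕ) r v → update f r v r ≡ v
  update-≡ {suc m} f zero    v = refl
  update-≡ {suc m} f (suc r) v = update-≡ (f ∘ suc) r v

  update-≢ : ∀ {m} (f : Fin m → ℕ) r v {i} → i ≢ r → update f r v i ≡ f i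
  update-≢ {suc m} f zero    v {zero}  i≢r = ⊥-elim (i≢r refl)
  update-≢ {suc m} f zero    v {suc i} i≢r = refl
  update-≢ {suc m} f (suc r) v {zero}  i≢r = refl
  update-≢ {suc m} f (suc r) v {suc i} i≢r = update-≢ (f ∘ suc) r v (i≢r ∘ cong suc)

  step-halt : ∀ {pc regs} → P pc ≡ halt → step P (pc , regs) ≡ nothing
  step-halt e rewrite e = refl

  step-inc : ∀ {pc regs r i} → P pc ≡ inc r i → step P (pc , regs) ≡ just (i , update regs r (suc (regs r)))
  step-inc e rewrite e = refl

  step-dec-suc : ∀ {pc regs r i i' v} → P pc ≡ dec r i i' → regs r ≡ suc v → step P (pc , regs) ≡ just (i , update regs r v)
  step-dec-suc e e' rewrite e | e' = refl

  step-dec-zero : ∀ {pc regs r i i'} → P pc ≡ dec r i i' → regs r ≡ zero → step P (pc , regs) ≡ just (i' , regs)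
  step-dec-zero e e' rewrite e | e' = refl

  Running : Config N K → Set
  Running (pc , _) = isHalt (P pc) ≡ false

  Tape : Word #letters → (Fin N → ℕ) → Set
  Tape X regs = All IsCell X × (∀ i → count (reg i) X ≡ regs i)

  record Encodes (x : Word #letters) (c : Config N K) : Set where
    constructor encoding
    field
      m     : ℕ
      X     : Word #letters
      shape : x ≡ blanks m ++ state (proj₁ c) ∷ X
      tape  : Tape X (proj₂ c)

  cell-running : ∀ {x} → IsCell x → halting x ≡ false
  cell-running blank-cell   = refl
  cell-running (reg-cell i) = halting-reg i

  encodes-haltFree : ∀ {x c} → Encodes x c → Running c → HaltFree x
  encodes-haltFree {c = pc , _} (encoding m X refl (cells , _)) running =
    ++⁺ (replicate⁺ m refl) (trans (halting-state pc) running ∷ All.map cell-running cells)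

  haltFree-running : ∀ {x c} → Encodes x c → HaltFree x → Running c
  haltFree-running {c = pc , _} (encoding m X refl _) hf with ++⁻ʳ (blanks m) hf
  ... | h ∷ _ = trans (sym (halting-state pc)) h

  encodes-∌carry : ∀ {x c} → Encodes x c → All (carry ≢_) x
  encodes-∌carry (encoding m X refl (cells , _)) =
    ++⁺ (replicate⁺ m (λ ())) ((λ ()) ∷ All.map (λ { blank-cell () ; (reg-cell i) () }) cells)

  doubling-needs-carry : ∀ {x y} → ⟦ doubling ⟧ x y → ¬ All (carry ≢_) x
  doubling-needs-carry (splits X₁ X₂ _ _ refl _ _ _) ∌carry with ++⁻ʳ X₁ ∌carry
  ... | carry≢carry ∷ _ = carry≢carry refl

  blanks-nonempty : ∀ m {a X} → blanks m ++ a ∷ X ≢ []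
  blanks-nonempty zero    ()
  blanks-nonempty (suc m) ()

  starting-⟦⟧ : ∀ {x y} → ⟦ starting ⟧ x y → x ≡ [] × y ≡ state zero ∷ []
  starting-⟦⟧ (maps _ [] refl) = refl , refl
  starting-⟦⟧ (maps _ (() ∷ _) _)

  tape-inc : ∀ {X Y regs r} → Tape X regs → ⟦ incBody r ⟧ X Y → Tape Y (update regs r (suc (regs r)))
  tape-inc {X} {regs = regs} {r} (cells , counts) body rewrite ⟦pointwise-just⟧ body =
    ++⁺ cells (reg-cell r ∷ []) , counts'
    where
    counts' : ∀ j → count (reg j) (X ∷ʳ reg r) ≡ update regs r (suc (regs r)) j
    counts' j with j ≟ r
    ... | yes refl = trans (count-∷ʳ-≡ (reg j) X) (trans (cong suc (counts j)) (sym (update-≡ regs j _)))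
    ... | no j≢r   = trans (count-∷ʳ-≢ X (j≢r ∘ reg-injective)) (trans (counts j) (sym (update-≢ regs r _ j≢r)))

  tape-dec : ∀ {X Y regs r} → Tape X regs → ⟦ decBody r ⟧ X Y →
             Σ ℕ λ v → regs r ≡ suc v × Tape Y (update regs r v)
  tape-dec {regs = regs} {r} (cells , counts) (splits Z₁ Z₂ W₁ W₂ refl refl pre body)
    with pointwise-identity (proj₁ ∘ keepAllBut-inv ∘ proj₁) pre | trans (⟦pointwise-just⟧ body) (++-identityʳ Z₂)
  ... | refl | refl =
    count (reg r) Z₁ + count (reg r) Z₂ , trans (sym (counts r)) (count-middle-≡ (reg r) Z₁ Z₂) ,
    ++⁺ (++⁻ˡ Z₁ cells) (blank-cell ∷ All.tail (++⁻ʳ Z₁ cells)) , counts'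
    where
    counts' : ∀ j → count (reg j) (Z₁ ++ blank ∷ Z₂) ≡ update regs r (count (reg r) Z₁ + count (reg r) Z₂) j
    counts' j with j ≟ r
    ... | yes refl = trans (count-middle-≢ Z₁ Z₂ λ ()) (sym (update-≡ regs j _))
    ... | no j≢r = trans (count-middle-≢ Z₁ Z₂ λ ())
                     (trans (sym (count-middle-≢ Z₁ Z₂ (j≢r ∘ reg-injective)))
                            (trans (counts j) (sym (update-≢ regs r _ j≢r))))

  tape-zero : ∀ {X Y regs r} → Tape X regs → ⟦ zeroBody r ⟧ X Y → regs r ≡ 0 × Tape Y regs
  tape-zero {X} {regs = regs} {r} tape@(cells , counts) (maps W W≈ refl)
    rewrite pointwise-identity (proj₁ ∘ keepAllBut-inv) W≈ | ++-identityʳ X =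
    trans (sym (counts r)) (∉⇒count≡0 (pointwise⇒All (proj₂ ∘ keepAllBut-inv) W≈)) , tape

  at-state : ∀ {x y pc regs p i S} → Encodes x (pc , regs) → ⟦ atState p i S ⟧ x y →
             p ≡ pc × Σ ℕ λ m → Σ (Word #letters) λ X → Σ (Word #letters) λ Y →
               Tape X regs × y ≡ blanks m ++ state i ∷ Y × ⟦ S ⟧ X Y
  at-state {pc = pc} {p = p} (encoding m X refl tape) rel with until-blanks (state≢blank p) (state≢blank pc) rel
  ... | p≡pc , Y , refl , body = state-injective p≡pc , m , X , Y , tape , refl , body

  move-simulates-step : ∀ {x y c} → Encodes x c → AnkeMove x y → Σ (Config N K) λ c' → step P c ≡ just c' × Encodes y c'
  move-simulates-step enc (_ , double , rel) = ⊥-elim (doubling-needs-carry rel (encodes-∌carry enc))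
  move-simulates-step {c = pc , _} (encoding m _ refl _) (_ , read b _ , rel) =
    ⊥-elim (until-blanks-mismatch (dig≢blank b) (state≢blank pc) (dig≢state b pc) rel)
  move-simulates-step {c = pc , _} (encoding m _ refl _) (_ , read-last b , rel) =
    ⊥-elim (until-blanks-mismatch (dig≢blank b) (state≢blank pc) (dig≢state b pc) rel)
  move-simulates-step (encoding m _ refl _) (_ , start-empty , rel) = ⊥-elim (blanks-nonempty m (proj₁ (starting-⟦⟧ rel)))
  move-simulates-step enc (_ , increment {r = r} {i} e , rel) with at-state enc rel
  ... | refl , m , X , Y , tape , refl , body = (i , _) , step-inc e , encoding m Y refl (tape-inc tape body)
  move-simulates-step enc (_ , decrement {r = r} {i} e , rel) with at-state enc rel
  ... | refl , m , X , Y , tape , refl , body with tape-dec tape body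
  ...   | v , r≡ , tape' = (i , _) , step-dec-suc e r≡ , encoding m Y refl tape'
  move-simulates-step enc (_ , test-zero {r = r} {i' = i'} e , rel) with at-state enc rel
  ... | refl , m , X , Y , tape , refl , body with tape-zero tape body
  ...   | r≡ , tape' = (i' , _) , step-dec-zero e r≡ , encoding m Y refl tape'

  running-can-move : ∀ {x c} → Encodes x c → Running c → Σ (Word #letters) λ y → AnkeMove x y
  running-can-move {c = pc , regs} (encoding m X refl tape) running with P pc in e
  ... | inc r i =
    _ , atState pc i (incBody r) , increment e ,
    until-blanks-⟦⟧ m (state≢blank pc) (pointwise-just-⟦⟧ (just (reg r)) X)
  ... | dec r i i' with count (reg r) X in c≡
  ...   | zero =
    _ , atState pc i' (zeroBody r) , test-zero e ,
    until-blanks-⟦⟧ m (state≢blank pc) (maps X (keep (count≡0⇒∉ (reg r) X c≡)) (sym (++-identityʳ X)))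
    where
    keep : ∀ {Z} → All (reg r ≢_) Z → Pointwise (Maps (keepAllBut r)) Z Z
    keep []       = []
    keep (q ∷ qs) = keepAllBut-≢ q ∷ keep qs
  ...   | suc v with count≡suc⇒split (reg r) X c≡
  ...     | Z₁ , Z₂ , refl , r∉Z₁ =
    _ , atState pc i (decBody r) , decrement e ,
    until-blanks-⟦⟧ m (state≢blank pc)
      (splits Z₁ Z₂ Z₁ (Z₂ ++ []) refl refl (avoid r∉Z₁) (pointwise-just-⟦⟧ nothing Z₂))
    where
    avoid : ∀ {Z} → All (reg r ≢_) Z → Pointwise (MapsAvoiding (keepAllBut r) (reg r) blank) Z Z
    avoid []       = []
    avoid (q ∷ qs) = (keepAllBut-≢ q , λ { (z≡ , _) → q (sym z≡) }) ∷ avoid qs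
  running-can-move {c = pc , regs} (encoding m X refl tape) () | halt

  -- Conversion phase

  Counters : Word #letters → ℕ → ℕ → Set
  Counters T nc na = All IsCounter T × count carry T ≡ nc × count unit T ≡ na

  -- The digit b is read next; a carry is worth two units, so 2·nc + na is
  -- twice the value of the digits already read.
  record Converting (x : Word #letters) (m : ℕ) (b : Bool) (ds : List Bool) (nc na : ℕ) : Set where
    constructor converting
    field
      T        : Word #letters
      shape    : x ≡ blanks m ++ dig b ∷ map dig ds ++ T
      counters : Counters T nc na

  binStep : ℕ → Bool → ℕ
  binStep acc d = 2 * acc + bit d

  value : Bool → List Bool → ℕ → ℕ → ℕ
  value b ds nc na = foldl binStep (2 * nc + na + bit b) ds

  value-double : ∀ b ds nc na → value b ds (suc nc) na ≡ value b ds nc (2 + na)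
  value-double b ds nc na = cong (λ acc → foldl binStep (acc + bit b) ds) (lemma nc na)
    where lemma : ∀ nc na → 2 * suc nc + na ≡ 2 * nc + (2 + na)
          lemma = solve-∀

  value-read : ∀ b b' ds na → value b (b' ∷ ds) 0 na ≡ value b' ds (na + bit b) 0
  value-read b b' ds na = cong (λ acc → foldl binStep (acc + bit b') ds) (sym (+-identityʳ (2 * (na + bit b))))

  initialRegs : ℕ → Fin N → ℕ
  initialRegs v = proj₂ (initConfig {n} {k} v)

  dig-not-counter : ∀ {b} → ¬ IsCounter (dig b)
  dig-not-counter {false} ()
  dig-not-counter {true}  ()

  counters-units : ∀ {T nc na} → Counters T nc na → All (_≡ unit) T → nc ≡ 0 × na ≡ length T
  counters-units (_ , refl , refl) units = ∉⇒count≡0 (All.map (λ { refl () }) units) , count-all units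

  counters-no-carry : ∀ {T na} → Counters T 0 na → All (_≡ unit) T
  counters-no-carry {T} (isC , c≡ , _) = go isC (count≡0⇒∉ carry T c≡)
    where
    go : ∀ {T} → All IsCounter T → All (carry ≢_) T → All (_≡ unit) T
    go []                   []       = []
    go (carry-counter ∷ _)  (q ∷ _)  = ⊥-elim (q refl)
    go (unit-counter ∷ cs)  (_ ∷ qs) = refl ∷ go cs qs

  carries-counters : ∀ {V} → All (_≡ carry) V → Counters V (length V) 0
  carries-counters carries = All.map (λ { refl → carry-counter }) carries , count-all carries ,
                             ∉⇒count≡0 (All.map (λ { refl () }) carries)

  units-tape : ∀ {U} → All (_≡ unit) U → Tape U (initialRegs (length U))
  units-tape {U} units = All.map (λ { refl → reg-cell zero }) units , counts
    where
    counts : ∀ i → count (reg i) U ≡ initialRegs (length U) i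
    counts zero    = count-all units
    counts (suc j) = ∉⇒count≡0 (All.map (λ { refl e → Fin.0≢1+n (sym (reg-injective {suc j} e)) }) units)

  length-mark : ∀ b c → length (fromMaybe (mark b c)) ≡ bit b
  length-mark false c = refl
  length-mark true  c = refl

  counters-double : ∀ {T₁ T₂ nc na} → Counters (T₁ ++ carry ∷ T₂) nc na →
                    Σ ℕ λ nc' → nc ≡ suc nc' × Counters (T₁ ++ unit ∷ T₂ ∷ʳ unit) nc' (2 + na)
  counters-double {T₁} {T₂} (isC , refl , refl) =
    count carry T₁ + count carry T₂ , count-middle-≡ carry T₁ T₂ ,
    ++⁺ (++⁻ˡ T₁ isC) (unit-counter ∷ ++⁺ (All.tail (++⁻ʳ T₁ isC)) (unit-counter ∷ [])) ,
    trans (count-middle-≢ T₁ (T₂ ∷ʳ unit) λ ()) (cong (count carry T₁ +_) (count-∷ʳ-≢ T₂ λ ())) ,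
    (begin
      count unit (T₁ ++ unit ∷ T₂ ∷ʳ unit)        ≡⟨ count-middle-≡ unit T₁ (T₂ ∷ʳ unit) ⟩
      suc (count unit T₁ + count unit (T₂ ∷ʳ unit)) ≡⟨ cong (λ c → suc (count unit T₁ + c)) (count-∷ʳ-≡ unit T₂) ⟩
      suc (count unit T₁ + suc (count unit T₂))    ≡⟨ cong suc (+-suc (count unit T₁) (count unit T₂)) ⟩
      2 + (count unit T₁ + count unit T₂)          ≡⟨ cong (2 +_) (sym (count-middle-≢ T₁ T₂ λ ())) ⟩
      2 + count unit (T₁ ++ carry ∷ T₂)            ∎)
    where open ≡-Reasoning

  header : ℕ → Bool → List Bool → Word #letters
  header m b ds = blanks m ++ dig b ∷ map dig ds

  header-++ : ∀ m b ds T → header m b ds ++ T ≡ blanks m ++ dig b ∷ map dig ds ++ T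
  header-++ m b ds T = ++-assoc (blanks m) (dig b ∷ map dig ds) T

  header-∌carry : ∀ m b ds → All (carry ≢_) (header m b ds)
  header-∌carry m b ds = ++⁺ (replicate⁺ m λ ()) (carry≢dig b ∷ map⁺ (All.universal carry≢dig ds))
    where
    carry≢dig : ∀ b → carry ≢ dig b
    carry≢dig false ()
    carry≢dig true  ()

  identity-avoiding : ∀ {a c} → a ≢ c → ∀ X → Pointwise (MapsAvoiding just a c) X X
  identity-avoiding a≢c []      = []
  identity-avoiding a≢c (x ∷ X) = (refl , λ { (x≡a , x≡c) → a≢c (trans (sym x≡a) x≡c) }) ∷ identity-avoiding a≢c X

  erase-prefix : ∀ {a c X Y} → Pointwise (MapsAvoiding erase a c) X Y → X ≡ [] × Y ≡ []
  erase-prefix []                = refl , refl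
  erase-prefix ((() , _) ∷ _)

  digits-then-counters : ∀ {T ds b' Z} → All IsCounter T → map dig ds ++ T ≡ dig b' ∷ Z →
                         Σ (List Bool) λ ds' → ds ≡ b' ∷ ds' × Z ≡ map dig ds' ++ T
  digits-then-counters {ds = []}    (c ∷ _) refl = ⊥-elim (dig-not-counter c)
  digits-then-counters {ds = d ∷ ds} _      eq with ∷-injective eq
  ... | d≡b' , refl with dig-injective d≡b'
  ...   | refl = ds , refl , refl

  carryUnits-digits : ∀ ds {V} → Pointwise (Maps carryUnits) (map dig ds) V → V ≡ map dig ds
  carryUnits-digits []       []       = refl
  carryUnits-digits (d ∷ ds) (r ∷ rs) = cong₂ _∷_ (carryUnits-dig r) (carryUnits-digits ds rs)

  carryUnits-counters : ∀ {T V} → All IsCounter T → Pointwise (Maps carryUnits) T V → All (_≡ unit) T × All (_≡ carry) V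
  carryUnits-counters []       []       = [] , []
  carryUnits-counters (c ∷ cs) (r ∷ rs) with carryUnits-counter c r | carryUnits-counters cs rs
  ... | refl , refl | units , carries = refl ∷ units , refl ∷ carries

  keepUnits-counters : ∀ {T V} → All IsCounter T → Pointwise (Maps keepUnits) T V → All (_≡ unit) T × V ≡ T
  keepUnits-counters []       []       = [] , refl
  keepUnits-counters (c ∷ cs) (r ∷ rs) with keepUnits-counter c r | keepUnits-counters cs rs
  ... | refl , refl | units , refl = refl ∷ units , refl

  read-tail : ∀ {T nc na ds b W} → Counters T nc na → ⟦ pointwise carryUnits (mark b carry) ⟧ (map dig ds ++ T) W →
              nc ≡ 0 × Σ (Word #letters) λ T' → W ≡ map dig ds ++ T' × Counters T' (na + bit b) 0
  read-tail {T} {ds = ds} {b} counters (maps V V≈ refl) with pointwise-++⁻ (map dig ds) V≈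
  ... | V₁ , V₂ , refl , digits , V₂≈ with carryUnits-digits ds digits | carryUnits-counters (proj₁ counters) V₂≈
  ... | refl | units , carries with counters-units counters units
  ...   | nc≡0 , refl =
    nc≡0 , V₂ ++ fromMaybe (mark b carry) , ++-assoc (map dig ds) V₂ _ ,
    subst (λ v → Counters (V₂ ++ fromMaybe (mark b carry)) v 0) length≡
          (carries-counters (++⁺ carries (mark-all b carry)))
    where
    length≡ : length (V₂ ++ fromMaybe (mark b carry)) ≡ length T + bit b
    length≡ = trans (length-++ V₂) (cong₂ _+_ (sym (Pointwise-length V₂≈)) (length-mark b carry))

  last-tail : ∀ {T nc na ds b W} → Counters T nc na → ⟦ pointwise keepUnits (mark b unit) ⟧ (map dig ds ++ T) W →
              nc ≡ 0 × ds ≡ [] × Tape W (initialRegs (na + bit b))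
  last-tail {ds = d ∷ ds} _ (maps _ (r ∷ _) _) = ⊥-elim (keepUnits-dig r)
  last-tail {T} {ds = []} {b} counters (maps V V≈ refl) with keepUnits-counters (proj₁ counters) V≈
  ... | units , refl with counters-units counters units
  ...   | nc≡0 , refl =
    nc≡0 , refl , subst (Tape (T ++ fromMaybe (mark b unit)) ∘ initialRegs) length≡ (units-tape (++⁺ units (mark-all b unit)))
    where
    length≡ : length (T ++ fromMaybe (mark b unit)) ≡ length T + bit b
    length≡ = trans (length-++ T) (cong (length T +_) (length-mark b unit))

  converting-double : ∀ {x y m b ds nc na} → Converting x m b ds nc na → ⟦ doubling ⟧ x y →
                Σ ℕ λ nc' → nc ≡ suc nc' × Converting y m b ds nc' (2 + na)
  converting-double {m = m} {b} {ds} (converting T refl counters) (splits X₁ X₂ Y₁ Y₂ x≡ refl pre body)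
    with pointwise-identity (λ r → sym (just-injective (proj₁ r))) pre | ⟦pointwise-just⟧ body
  ... | refl | refl with ∉-split (header-∌carry m b ds) (trans (sym x≡) (sym (header-++ m b ds T)))
  ...   | T₁ , refl , refl with counters-double counters
  ...     | nc' , nc≡ , counters' =
    nc' , nc≡ , converting (T₁ ++ unit ∷ X₂ ∷ʳ unit)
    (trans (++-assoc (header m b ds) T₁ _) (header-++ m b ds _)) counters'

  converting-read : ∀ {x y m b b₀ b₁ ds nc na} → Converting x m b ds nc na → ⟦ reading b₀ b₁ ⟧ x y →
              nc ≡ 0 × Σ (List Bool) λ ds' → ds ≡ b₁ ∷ ds' × Converting y (suc m) b₁ ds' (na + bit b) 0
  converting-read {m = m} {b} (converting T refl counters) rel with until-blanks (dig≢blank _) (dig≢blank b) rel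
  ... | b₀≡b , Y , refl , splits Z₁ Z₂ W₁ W₂ Z≡ refl pre body with dig-injective b₀≡b | erase-prefix pre
  ... | refl | refl , refl with digits-then-counters (proj₁ counters) Z≡
  ... | ds' , refl , refl with read-tail counters body
  ... | nc≡0 , T' , refl , counters' = nc≡0 , ds' , refl , converting T' (blanks-snoc m _) counters'

  converting-read-last : ∀ {x y m b b₀ ds nc na} → Converting x m b ds nc na → ⟦ reading-last b₀ ⟧ x y →
                   nc ≡ 0 × ds ≡ [] × Encodes y (initConfig (na + bit b))
  converting-read-last {m = m} {b} (converting T refl counters) rel with until-blanks (dig≢blank _) (dig≢blank b) rel
  ... | b₀≡b , Y , refl , body with dig-injective b₀≡b
  ... | refl with last-tail counters body
  ... | nc≡0 , refl , tape = nc≡0 , refl , encoding m Y refl tape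

  converting-not-starting : ∀ {x y m b ds nc na} → Converting x m b ds nc na → ¬ ⟦ starting ⟧ x y
  converting-not-starting {m = m} (converting _ refl _) = blanks-nonempty m ∘ proj₁ ∘ starting-⟦⟧

  converting-not-atState : ∀ {x y m b ds nc na p i S} → Converting x m b ds nc na → ¬ ⟦ atState p i S ⟧ x y
  converting-not-atState {b = b} {p = p} (converting _ refl _) =
    until-blanks-mismatch (state≢blank p) (dig≢blank b) (dig≢state b p ∘ sym)

  double-exists : ∀ {x m b ds nc na} → Converting x m b ds (suc nc) na → Σ (Word #letters) λ y → ⟦ doubling ⟧ x y
  double-exists {m = m} {b} {ds} (converting T refl (_ , c≡ , _)) with count≡suc⇒split carry T c≡
  ... | T₁ , T₂ , refl , _ =
    _ , splits (header m b ds ++ T₁) T₂ (header m b ds ++ T₁) (T₂ ∷ʳ unit)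
               (trans (sym (header-++ m b ds _)) (sym (++-assoc (header m b ds) T₁ _))) refl
               (identity-avoiding (λ ()) (header m b ds ++ T₁)) (pointwise-just-⟦⟧ (just unit) T₂)

  read-exists : ∀ {x m b b' ds na} → Converting x m b (b' ∷ ds) 0 na → Σ (Word #letters) λ y → ⟦ reading b b' ⟧ x y
  read-exists {m = m} {b} {b'} {ds} (converting T refl counters) =
    _ , until-blanks-⟦⟧ m (dig≢blank b)
          (splits [] (map dig ds ++ T) [] _ refl refl []
            (maps (map dig ds ++ map (const carry) T)
                  (Pointwise.++⁺ (digits ds) (units (counters-no-carry counters))) refl))
    where
    digits : ∀ ds → Pointwise (Maps carryUnits) (map dig ds) (map dig ds)
    digits []           = []
    digits (false ∷ ds) = refl ∷ digits ds
    digits (true ∷ ds)  = refl ∷ digits ds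
    units : ∀ {T} → All (_≡ unit) T → Pointwise (Maps carryUnits) T (map (const carry) T)
    units []          = []
    units (refl ∷ us) = refl ∷ units us

  read-last-exists : ∀ {x m b na} → Converting x m b [] 0 na → Σ (Word #letters) λ y → ⟦ reading-last b ⟧ x y
  read-last-exists {m = m} {b} (converting T refl counters) =
    _ , until-blanks-⟦⟧ m (dig≢blank b) (maps T (units (counters-no-carry counters)) refl)
    where
    units : ∀ {T} → All (_≡ unit) T → Pointwise (Maps keepUnits) T T
    units []          = []
    units (refl ∷ us) = refl ∷ units us

  converting-haltFree : ∀ {x m b ds nc na} → Converting x m b ds nc na → HaltFree x
  converting-haltFree {m = m} {b} {ds} (converting T refl (isC , _)) =
    ++⁺ (replicate⁺ m refl) (dig-running b ∷ ++⁺ (map⁺ (All.universal dig-running ds)) (All.map counter-running isC))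
    where
    dig-running : ∀ b → halting (dig b) ≡ false
    dig-running false = refl
    dig-running true  = refl
    counter-running : ∀ {x} → IsCounter x → halting x ≡ false
    counter-running carry-counter = refl
    counter-running unit-counter  = halting-reg zero

  isHalt-true : ∀ {ins} → isHalt ins ≡ true → ins ≡ halt
  isHalt-true {halt} refl = refl

  halting-from-haltFree : ∀ {y c} → Encodes y c → (HaltFree y → Halting P c) → Halting P c
  halting-from-haltFree {c = pc , _} enc h with isHalt (P pc) in e
  ... | true  = stop (step-halt (isHalt-true e))
  ... | false = h (encodes-haltFree enc e)

  simulation-halts : ∀ {x c} → Wins x → Encodes x c → Halting P c
  simulation-halts (play mv k) enc with move-simulates-step enc mv
  ... | c' , step≡ , enc' = next step≡ (halting-from-haltFree enc' λ hf → simulation-halts (k hf) enc')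

  halting-wins : ∀ {x c} → Halting P c → Encodes x c → Running c → Wins x
  halting-wins (stop halted) enc running with move-simulates-step enc (proj₂ (running-can-move enc running))
  ... | _ , step≡ , _ with trans (sym halted) step≡
  ...   | ()
  halting-wins (next step≡ h) enc running with running-can-move enc running
  ... | y , mv with move-simulates-step enc mv
  ...   | c' , step≡' , enc' with trans (sym step≡) step≡'
  ...     | refl = play mv λ hf → halting-wins h enc' (haltFree-running enc' hf)

  conversion-halts : ∀ {x m b ds nc na} → Wins x → Converting x m b ds nc na → Halting P (initConfig (value b ds nc na))
  conversion-halts {b = b} {ds} {na = na} (play (_ , double , rel) k) cx with converting-double cx rel
  ... | nc' , refl , cy = subst (Halting P ∘ initConfig) (sym (value-double b ds nc' na))
                                (conversion-halts (k (converting-haltFree cy)) cy)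
  conversion-halts {b = b} {na = na} (play (_ , read _ b' , rel) k) cx with converting-read cx rel
  ... | refl , ds' , refl , cy = subst (Halting P ∘ initConfig) (sym (value-read b b' ds' na))
                                       (conversion-halts (k (converting-haltFree cy)) cy)
  conversion-halts (play (_ , read-last _ , rel) k) cx with converting-read-last cx rel
  ... | refl , refl , enc = halting-from-haltFree enc λ hf → simulation-halts (k hf) enc
  conversion-halts (play (_ , start-empty , rel) _) cx = ⊥-elim (converting-not-starting cx rel)
  conversion-halts (play (_ , increment _ , rel) _) cx = ⊥-elim (converting-not-atState cx rel)
  conversion-halts (play (_ , decrement _ , rel) _) cx = ⊥-elim (converting-not-atState cx rel)
  conversion-halts (play (_ , test-zero _ , rel) _) cx = ⊥-elim (converting-not-atState cx rel)

  conversion-wins : ∀ {x m b ds nc na} → Halting P (initConfig (value b ds nc na)) → Converting x m b ds nc na → Wins x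
  conversion-wins {m = m} {b} {ds} {suc nc} {na} h cx with double-exists cx
  ... | y , rel = play (doubling , double , rel) λ _ → continue (converting-double cx rel)
    where
    continue : Σ ℕ (λ nc' → suc nc ≡ suc nc' × Converting y m b ds nc' (2 + na)) → Wins y
    continue (_ , refl , cy) = conversion-wins (subst (Halting P ∘ initConfig) (value-double b ds nc na) h) cy
  conversion-wins {m = m} {b} {b' ∷ ds} {zero} {na} h cx with read-exists cx
  ... | y , rel = play (reading b b' , read b b' , rel) λ _ → continue (converting-read cx rel)
    where
    continue : 0 ≡ 0 × Σ (List Bool) (λ ds' → b' ∷ ds ≡ b' ∷ ds' × Converting y (suc m) b' ds' (na + bit b) 0) → Wins y
    continue (_ , _ , refl , cy) = conversion-wins (subst (Halting P ∘ initConfig) (value-read b b' ds na) h) cy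
  conversion-wins {b = b} {[]} {zero} h cx with read-last-exists cx
  ... | y , rel = play (reading-last b , read-last b , rel) λ hf →
    let enc = proj₂ (proj₂ (converting-read-last cx rel)) in halting-wins h enc (haltFree-running enc hf)

  initial-encoding : Encodes (state zero ∷ []) (initConfig 0)
  initial-encoding = encoding 0 [] refl ([] , λ { zero → refl ; (suc _) → refl })

  initial-converting : ∀ b ds → Converting (map dig (b ∷ ds)) 0 b ds 0 0
  initial-converting b ds = converting [] (cong (dig b ∷_) (sym (++-identityʳ (map dig ds)))) ([] , refl , refl)

  wins⇒halts : ∀ w → Wins (map dig w) → Halting P (initConfig (binValue w))
  wins⇒halts (b ∷ ds) win = conversion-halts win (initial-converting b ds)
  wins⇒halts [] (play (_ , start-empty , rel) k) with starting-⟦⟧ rel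
  ... | _ , refl = halting-from-haltFree initial-encoding λ hf → simulation-halts (k hf) initial-encoding
  wins⇒halts [] (play (_ , double , rel) _)      = ⊥-elim (until-nonempty rel)
  wins⇒halts [] (play (_ , read _ _ , rel) _)    = ⊥-elim (until-nonempty rel)
  wins⇒halts [] (play (_ , read-last _ , rel) _) = ⊥-elim (until-nonempty rel)
  wins⇒halts [] (play (_ , increment _ , rel) _) = ⊥-elim (until-nonempty rel)
  wins⇒halts [] (play (_ , decrement _ , rel) _) = ⊥-elim (until-nonempty rel)
  wins⇒halts [] (play (_ , test-zero _ , rel) _) = ⊥-elim (until-nonempty rel)

  halts⇒wins : ∀ w → Halting P (initConfig (binValue w)) → Wins (map dig w)
  halts⇒wins (b ∷ ds) h = conversion-wins h (initial-converting b ds)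
  halts⇒wins [] h = play (starting , start-empty , maps [] [] refl) λ hf →
    halting-wins h initial-encoding (haltFree-running initial-encoding hf)

proposition1 : (n k : ℕ) (P : Program (suc n) (suc k)) →
    Σ AARM λ M → (w : List Bool) →
      (AARMAccepts M w → Halts P (initConfig (binValue w))) ×
      (Halts P (initConfig (binValue w)) → AARMAccepts M w)
proposition1 n k P = M , λ w →
  (λ accepts → Halting⇒Halts P (wins⇒halts w (AnkeWins⇒Wins accepts))) ,
  (λ halts → Wins⇒AnkeWins (halts⇒wins w (Halts⇒Halting P halts)))
  where open Simulation n k P
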